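{- Let $T\in\mathbb{T}$. Then every alternating path in $T$ has length at most three.
   Context: $\mathbb{T}$ is the class of simple undirected weighted trees (nonzero real edge weights) $T$ such that (i) $T$ has at least one non-pendant vertex, and (ii) every non-pendant vertex of $T$ is adjacent to at least one pendant vertex (a vertex of degree one). A maximum matching is a set of pairwise vertex-disjoint edges of maximum cardinality. A path is alternating with respect to a maximum matching $M$ if its edges lie alternately in $M$ and not in $M$, with first and last edges in $M$; an alternating path in $T$ is a path alternating with respect to some maximum matching of $T$. -}

module Defs where

open import Data.Nat using (ℕ; _≤_; _∸_)
open import Data.Bool using (Bool; true; false)
open import Data.Fin using (Fin)
open import Data.List using (List; []; _∷_; length; head; last; filterᵇ; allFin; concatMap)
open import Data.List.Membership.Propositional using (_∈_)
open import Data.List.Relation.Unary.All using (All)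
open import Data.List.Relation.Unary.Unique.Propositional using (Unique)
open import Data.List.Relation.Unary.Linked using (Linked)
open import Data.Maybe using (just)
open import Data.Product using (_×_; _,_; ∃; ∃-syntax)
open import Data.Sum using (_⊎_)
open import Relation.Binary.PropositionalEquality using (_≡_)
open import Relation.Nullary using (¬_)

record Graph (n : ℕ) : Set where
  field
    adj    : Fin n → Fin n → Bool
    adj-sym : ∀ u v → adj u v ≡ adj v u
    adj-irr : ∀ u → adj u u ≡ false
open Graph public

Adj : ∀ {n} → Graph n → Fin n → Fin n → Set
Adj G u v = adj G u v ≡ true

degree : ∀ {n} → Graph n → Fin n → ℕ
degree {n} G v = length (filterᵇ (adj G v) (allFin n))

Pendant : ∀ {n} → Graph n → Fin n → Set
Pendant G v = degree G v ≡ 1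

NonPendant : ∀ {n} → Graph n → Fin n → Set
NonPendant G v = ¬ Pendant G v

IsPath : ∀ {n} → Graph n → List (Fin n) → Set
IsPath G vs = Unique vs × Linked (Adj G) vs

pathLength : ∀ {n} → List (Fin n) → ℕ
pathLength vs = length vs ∸ 1

IsPathBetween : ∀ {n} → Graph n → Fin n → Fin n → List (Fin n) → Set
IsPathBetween G u v vs = IsPath G vs × head vs ≡ just u × last vs ≡ just v

Connected : ∀ {n} → Graph n → Set
Connected {n} G = ∀ (u v : Fin n) → ∃[ vs ] IsPathBetween G u v vs

IsCycle : ∀ {n} → Graph n → List (Fin n) → Set
IsCycle {n} G vs = IsPath G vs × 3 ≤ length vs
  × ∃[ u ] ∃[ w ] (head vs ≡ just u × last vs ≡ just w × Adj G w u)

Acyclic : ∀ {n} → Graph n → Set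
Acyclic G = ∀ vs → ¬ IsCycle G vs

IsTree : ∀ {n} → Graph n → Set
IsTree G = Connected G × Acyclic G

-- The class 𝕋 (edge weights play no role).
InClassT : ∀ {n} → Graph n → Set
InClassT {n} G = IsTree G
  × (∃[ v ] NonPendant G v)
  × (∀ v → NonPendant G v → ∃[ u ] (Adj G v u × Pendant G u))

endpoints : ∀ {n} → List (Fin n × Fin n) → List (Fin n)
endpoints = concatMap (λ { (u , v) → u ∷ v ∷ [] })

IsMatching : ∀ {n} → Graph n → List (Fin n × Fin n) → Set
IsMatching G M = All (λ { (u , v) → Adj G u v }) M × Unique (endpoints M)

IsMaximumMatching : ∀ {n} → Graph n → List (Fin n × Fin n) → Set
IsMaximumMatching G M = IsMatching G M × (∀ M' → IsMatching G M' → length M' ≤ length M)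

InM : ∀ {n} → List (Fin n × Fin n) → Fin n → Fin n → Set
InM M u v = (u , v) ∈ M ⊎ (v , u) ∈ M

-- Edge sequence of the vertex list alternates in M / not in M, first and last edge in M.
data Alternates {n} (M : List (Fin n × Fin n)) : List (Fin n) → Set where
  alt-one  : ∀ {u v} → InM M u v → Alternates M (u ∷ v ∷ [])
  alt-more : ∀ {u v w rest} → InM M u v → ¬ InM M v w →
             Alternates M (w ∷ rest) → Alternates M (u ∷ v ∷ w ∷ rest)

IsAlternatingPathWrt : ∀ {n} → Graph n → List (Fin n × Fin n) → List (Fin n) → Set
IsAlternatingPathWrt G M vs = IsPath G vs × Alternates M vs

IsAlternatingPath : ∀ {n} → Graph n → List (Fin n) → Set
IsAlternatingPath G vs = ∃[ M ] (IsMaximumMatching G M × IsAlternatingPathWrt G M vs)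

{-# OPTIONS --safe #-}
module Submission where

-- In a maximum matching every edge has a pendant end, provided every non-pendant vertex has a
-- pendant neighbour: if c and d were both non-pendant, with pendant neighbours p and q, then p and q
-- are unmatched (their only neighbours c, d are matched to each other) and p c d q is an augmenting path.
-- On an alternating path a b c d e … the matched edge cd has both ends of degree at least two,
-- so no such path exists.

open import Defs
open import Data.Nat using (ℕ; _≤_; suc; s≤s; z≤n)
open import Data.Nat.Properties using (m≤n⇒m≤1+n; <-irrefl)
open import Data.Fin using (Fin; _≟_)
open import Data.Bool using (T; T?)
open import Data.List using (List; []; _∷_; _++_; length; filterᵇ; allFin)
open import Data.List.Membership.Propositional using (_∈_; _∉_)
open import Data.List.Membership.Propositional.Properties using (∈-filter⁺; ∈-allFin; ∈-∃++)
open import Data.List.Relation.Unary.All using (All; _∷_)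
open import Data.List.Relation.Unary.All.Properties using (¬Any⇒All¬; All¬⇒¬Any)
open import Data.List.Relation.Unary.Any using (here; there)
open import Data.List.Relation.Unary.AllPairs using (_∷_)
open import Data.List.Relation.Unary.Linked using (_∷_)
open import Data.List.Relation.Binary.Permutation.Propositional using (_↭_; refl; prep; swap; trans; ↭⇒↭ₛ)
open import Data.List.Relation.Binary.Permutation.Propositional.Properties
  using (All-resp-↭; ↭-length; ++⁺ˡ; shift; shifts)
import Data.List.Relation.Binary.Permutation.Setoid.Properties as Setoid↭
open import Data.Empty using (⊥; ⊥-elim)
open import Data.Unit using (tt)
open import Data.Sum using (inj₁; inj₂)
open import Data.Product using (_×_; _,_; ∃-syntax; uncurry)
open import Relation.Nullary using (yes; no; contradiction)
open import Relation.Binary.PropositionalEquality as ≡ using (_≡_; _≢_; refl; sym; subst)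

distinct-∈⇒2≤length : ∀ {A : Set} {a b : A} {xs : List A} → a ∈ xs → b ∈ xs → a ≢ b → 2 ≤ length xs
distinct-∈⇒2≤length (here refl) (here refl) a≢b = contradiction refl a≢b
distinct-∈⇒2≤length {xs = _ ∷ _ ∷ _} (here refl) (there _) _ = s≤s (s≤s z≤n)
distinct-∈⇒2≤length {xs = _ ∷ _ ∷ _} (there _) (here refl) _ = s≤s (s≤s z≤n)
distinct-∈⇒2≤length (there a∈) (there b∈) a≢b = m≤n⇒m≤1+n (distinct-∈⇒2≤length a∈ b∈ a≢b)

∈⇒↭∷ : ∀ {A : Set} {x : A} {xs : List A} → x ∈ xs → ∃[ ys ] (xs ↭ x ∷ ys)
∈⇒↭∷ {x = x} x∈xs with ys , zs , refl ← ∈-∃++ x∈xs = ys ++ zs , shift x ys zs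

endpoints-↭ : ∀ {n} {M M' : List (Fin n × Fin n)} → M ↭ M' → endpoints M ↭ endpoints M'
endpoints-↭ refl = refl
endpoints-↭ (prep (u , v) M↭M') = ++⁺ˡ (u ∷ v ∷ []) (endpoints-↭ M↭M')
endpoints-↭ (swap (u , v) (u' , v') M↭M') =
  trans (++⁺ˡ (u ∷ v ∷ []) (++⁺ˡ (u' ∷ v' ∷ []) (endpoints-↭ M↭M'))) (shifts (u ∷ v ∷ []) (u' ∷ v' ∷ []))
endpoints-↭ (trans M↭M' M'↭M'') = trans (endpoints-↭ M↭M') (endpoints-↭ M'↭M'')

module _ {n : ℕ} (G : Graph n) where

  Adj-sym : ∀ {u v} → Adj G u v → Adj G v u
  Adj-sym {u} {v} uv = ≡.trans (adj-sym G v u) uv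

  Adj-irrefl : ∀ {u v} → Adj G u v → u ≢ v
  Adj-irrefl {u} uu refl with ≡.trans (sym (adj-irr G u)) uu
  ... | ()

  Adj⇒∈neighbours : ∀ {v w} → Adj G v w → w ∈ filterᵇ (adj G v) (allFin n)
  Adj⇒∈neighbours {v} {w} vw = ∈-filter⁺ (λ x → T? (adj G v x)) (∈-allFin w) (subst T (sym vw) tt)

  two-neighbours⇒nonPendant : ∀ {v a b} → Adj G v a → Adj G v b → a ≢ b → NonPendant G v
  two-neighbours⇒nonPendant va vb a≢b deg≡1
    with subst (2 ≤_) deg≡1 (distinct-∈⇒2≤length (Adj⇒∈neighbours va) (Adj⇒∈neighbours vb) a≢b)
  ... | s≤s ()

  pendant-neighbour-unique : ∀ {p a b} → Pendant G p → Adj G p a → Adj G p b → a ≡ b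
  pendant-neighbour-unique {a = a} {b} pendant pa pb with a ≟ b
  ... | yes a≡b = a≡b
  ... | no a≢b = contradiction pendant (two-neighbours⇒nonPendant pa pb a≢b)

  IsMatching-resp-↭ : ∀ {M M'} → M ↭ M' → IsMatching G M → IsMatching G M'
  IsMatching-resp-↭ M↭M' (edges , unique) =
    All-resp-↭ M↭M' edges , Setoid↭.Unique-resp-↭ (≡.setoid _) (↭⇒↭ₛ (endpoints-↭ M↭M')) unique

  matched-neighbour : ∀ {R v} → All (uncurry (Adj G)) R → v ∈ endpoints R →
    ∃[ w ] (Adj G v w × w ∈ endpoints R)
  matched-neighbour {(u , w) ∷ _} (uw ∷ _) (here refl) = w , uw , there (here refl)
  matched-neighbour {(u , w) ∷ _} (uw ∷ _) (there (here refl)) = u , Adj-sym uw , here refl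
  matched-neighbour {_ ∷ _} (_ ∷ edges) (there (there v∈R)) with matched-neighbour edges v∈R
  ... | w , vw , w∈R = w , vw , there (there w∈R)

  pendant-unmatched : ∀ {R p u} → All (uncurry (Adj G)) R → Pendant G p → Adj G p u →
    u ∉ endpoints R → p ∉ endpoints R
  pendant-unmatched edges pendant pu u∉R p∈R with matched-neighbour edges p∈R
  ... | w , pw , w∈R = u∉R (subst (_∈ _) (pendant-neighbour-unique pendant pw pu) w∈R)

  augment : ∀ {R c d p q} → IsMatching G ((c , d) ∷ R) →
    Adj G p c → Pendant G p → NonPendant G c →
    Adj G d q → Pendant G q → NonPendant G d →
    IsMatching G ((p , c) ∷ (d , q) ∷ R)
  augment {R} {c} {d} {p} {q} (cd ∷ edges , (c≢d ∷ c∉R) ∷ d∉R ∷ unique)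
          pc pendant-p nonPendant-c dq pendant-q nonPendant-d =
    pc ∷ dq ∷ edges ,
    (Adj-irrefl pc ∷ p≢d ∷ p≢q ∷ ¬Any⇒All¬ _ p∉R) ∷
    (c≢d ∷ c≢q ∷ c∉R) ∷
    (Adj-irrefl dq ∷ d∉R) ∷
    ¬Any⇒All¬ _ q∉R ∷ unique
    where
    p≢d : p ≢ d
    p≢d refl = nonPendant-d pendant-p
    c≢q : c ≢ q
    c≢q refl = nonPendant-c pendant-q
    p≢q : p ≢ q
    p≢q refl = Adj-irrefl cd (pendant-neighbour-unique pendant-p pc (Adj-sym dq))
    p∉R : p ∉ endpoints R
    p∉R = pendant-unmatched edges pendant-p pc (All¬⇒¬Any c∉R)
    q∉R : q ∉ endpoints R
    q∉R = pendant-unmatched edges pendant-q (Adj-sym dq) (All¬⇒¬Any d∉R)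

  NonPendantsHavePendantNeighbours : Set
  NonPendantsHavePendantNeighbours = ∀ v → NonPendant G v → ∃[ u ] (Adj G v u × Pendant G u)

  maximum-matching-edge-has-pendant-end : NonPendantsHavePendantNeighbours →
    ∀ {M c d} → IsMaximumMatching G M → (c , d) ∈ M → NonPendant G c → NonPendant G d → ⊥
  maximum-matching-edge-has-pendant-end pendantNeighbour {c = c} {d} (matching , maximum) cd∈M
                                        nonPendant-c nonPendant-d
    with R , M↭cdR ← ∈⇒↭∷ cd∈M
       | p , cp , pendant-p ← pendantNeighbour _ nonPendant-c
       | q , dq , pendant-q ← pendantNeighbour _ nonPendant-d =
    <-irrefl refl (subst (suc (suc (length R)) ≤_) (↭-length M↭cdR) (maximum _ augmented))
    where
    augmented : IsMatching G ((p , c) ∷ (d , q) ∷ R)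
    augmented = augment (IsMatching-resp-↭ M↭cdR matching)
      (Adj-sym cp) pendant-p nonPendant-c dq pendant-q nonPendant-d

  maximum-matching-InM-has-pendant-end : NonPendantsHavePendantNeighbours →
    ∀ {M c d} → IsMaximumMatching G M → InM M c d → NonPendant G c → NonPendant G d → ⊥
  maximum-matching-InM-has-pendant-end pendantNeighbour maximum (inj₁ cd∈M) nonPendant-c nonPendant-d =
    maximum-matching-edge-has-pendant-end pendantNeighbour maximum cd∈M nonPendant-c nonPendant-d
  maximum-matching-InM-has-pendant-end pendantNeighbour maximum (inj₂ dc∈M) nonPendant-c nonPendant-d =
    maximum-matching-edge-has-pendant-end pendantNeighbour maximum dc∈M nonPendant-d nonPendant-c

  alternating-path-third-edge : ∀ {M a b c d e rest} → IsAlternatingPathWrt G M (a ∷ b ∷ c ∷ d ∷ e ∷ rest) →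
    InM M c d × NonPendant G c × NonPendant G d
  alternating-path-third-edge
    ((_ ∷ (_ ∷ b≢d ∷ _) ∷ (_ ∷ c≢e ∷ _) ∷ _ , _ ∷ bc ∷ cd ∷ de ∷ _) , alt-more _ _ (alt-more cd∈M _ _)) =
    cd∈M , two-neighbours⇒nonPendant (Adj-sym bc) cd b≢d , two-neighbours⇒nonPendant (Adj-sym cd) de c≢e

corollary3p4 : ∀ (n : ℕ) (T : Graph n) → InClassT T →
    ∀ (vs : List (Fin n)) → IsAlternatingPath T vs → pathLength vs ≤ 3
corollary3p4 _ _ _ [] _ = z≤n
corollary3p4 _ _ _ (_ ∷ []) _ = z≤n
corollary3p4 _ _ _ (_ ∷ _ ∷ []) _ = s≤s z≤n
corollary3p4 _ _ _ (_ ∷ _ ∷ _ ∷ []) _ = s≤s (s≤s z≤n)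
corollary3p4 _ _ _ (_ ∷ _ ∷ _ ∷ _ ∷ []) _ = s≤s (s≤s (s≤s z≤n))
corollary3p4 _ T (_ , _ , pendantNeighbour) (_ ∷ _ ∷ _ ∷ _ ∷ _ ∷ _) (_ , maximum , alternating)
  with cd∈M , nonPendant-c , nonPendant-d ← alternating-path-third-edge T alternating =
  ⊥-elim (maximum-matching-InM-has-pendant-end T pendantNeighbour maximum cd∈M nonPendant-c nonPendant-d)
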